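{- Let $n\geq 1$ and $1\leq l\leq \left\lfloor\frac{n+1}{2}\right\rfloor$. Then $\sigma^{ - }(S_m(l))=\left\lfloor\frac{n+1}{2}\right\rfloor-l+1$, where $S_m(l)$ is the spider of order $n+1$ described below.
   Context: For a connected simple graph $G$ of order $p$, a parity labelling is a bijection $f:V(G)\to\{1,\ldots,p\}$; an edge $uv$ is negative if $f(u),f(v)$ have opposite parity. The rna number $\sigma^{ - }(G)$ is the minimum over all such $f$ of the number of negative edges. For $l\geq 2$, the spider $S_m(l)$ is the tree consisting of a central vertex $u_0$ together with $m$ internally disjoint paths (legs) starting at $u_0$, one of which has length $l$ (i.e. $l$ edges) and the remaining $m-1$ of which have length $1$; here its order is $n+1$, so $m=n+1-l$. By convention $S_m(1)=K_{1,n}$, the star with $n$ leaves. -}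

module Defs where

open import Data.Nat using (ℕ; zero; suc; _+_; _≤_; _<ᵇ_; _≡ᵇ_; _≤ᵇ_)
open import Data.Nat.Base using (_%_)
open import Data.Bool using (Bool; true; false; _∧_; _∨_; not; if_then_else_)
open import Data.Fin using (Fin; toℕ)
open import Data.List using (List; map; allFin)
open import Data.Nat.ListAction using (sum)
open import Data.Bool.Properties using (∨-comm; ∧-zeroʳ; ∨-idem)
open import Relation.Binary.PropositionalEquality using (refl; cong₂)
open import Data.Product using (Σ; _×_; ∃)
open import Function.Bundles using (_⤖_; Bijection)
open import Relation.Binary.PropositionalEquality using (_≡_)

record SimpleGraph (p : ℕ) : Set where
  field
    adj   : Fin p → Fin p → Bool
    sym   : ∀ u v → adj u v ≡ adj v u
    irrefl : ∀ u → adj u u ≡ false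
open SimpleGraph public

-- A labelling is a bijection f : V(G) → {1,…,p}; we represent {1,…,p} by
-- Fin p, with vertex v receiving the label  1 + toℕ (f v).
Labelling : ℕ → Set
Labelling p = Fin p ⤖ Fin p

label : ∀ {p} → Labelling p → Fin p → ℕ
label f v = suc (toℕ (Bijection.to f v))

isOdd : ℕ → Bool
isOdd k = (k % 2) ≡ᵇ 1

oppParity : ℕ → ℕ → Bool
oppParity a b = not (isOdd a ≡ᵇool isOdd b)
  where
  _≡ᵇool_ : Bool → Bool → Bool
  true ≡ᵇool y = y
  false ≡ᵇool y = not y

boolToℕ : Bool → ℕ
boolToℕ true = 1
boolToℕ false = 0

-- Number of negative edges: each edge {u,v} counted once, via u < v.
negEdges : ∀ {p} → SimpleGraph p → Labelling p → ℕ
negEdges {p} G f =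
  sum (map (λ u → sum (map (λ v →
         boolToℕ ((toℕ u <ᵇ toℕ v) ∧ adj G u v ∧ oppParity (label f u) (label f v)))
       (allFin p))) (allFin p))

IsRnaNumber : ∀ {p} → SimpleGraph p → ℕ → Set
IsRnaNumber {p} G k =
  (Σ (Labelling p) λ f → negEdges G f ≡ k) × (∀ (f : Labelling p) → k ≤ negEdges G f)

-- Spider of order n+1 with one leg of length l.  Vertex 0 is the centre u₀,
-- vertices 1,…,l form the long leg u₀ - 1 - 2 - … - l, and vertices
-- l+1,…,n are leaves adjacent to u₀.
spiderEdge : ℕ → ℕ → ℕ → Bool
spiderEdge l i j = ((j ≤ᵇ l) ∧ (j ≡ᵇ suc i)) ∨ ((i ≡ᵇ 0) ∧ (l <ᵇ j))

spiderAdj : (n l : ℕ) → Fin (suc n) → Fin (suc n) → Bool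
spiderAdj n l u v = spiderEdge l (toℕ u) (toℕ v) ∨ spiderEdge l (toℕ v) (toℕ u)

private
  ≡ᵇ-suc : ∀ i → (i ≡ᵇ suc i) ≡ false
  ≡ᵇ-suc zero = refl
  ≡ᵇ-suc (suc i) = ≡ᵇ-suc i

  zl : ∀ l i → ((i ≡ᵇ 0) ∧ (l <ᵇ i)) ≡ false
  zl l zero = refl
  zl l (suc i) = refl

  spiderEdge-irrefl : ∀ l i → spiderEdge l i i ≡ false
  spiderEdge-irrefl l i rewrite ≡ᵇ-suc i | ∧-zeroʳ (i ≤ᵇ l) | zl l i = refl

spider : (n l : ℕ) → SimpleGraph (suc n)
spider n l = record
  { adj = spiderAdj n l
  ; sym = λ u v → ∨-comm (spiderEdge l (toℕ u) (toℕ v)) (spiderEdge l (toℕ v) (toℕ u))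
  ; irrefl = λ u → cong₂ _∨_ (spiderEdge-irrefl l (toℕ u)) (spiderEdge-irrefl l (toℕ u))
  }

-- Write g for the parity of the labels.  Every vertex 1 + k of the spider has exactly one
-- smaller neighbour (k on the long leg, the centre otherwise), so the negative edges are the
-- P disagreements of g along the long leg plus the L disagreements between the centre and the
-- vertices off the long leg.  Since the labels are 1, …, n + 1, at least ⌊ (n + 1)/2 ⌋ vertices
-- have the parity opposite to the centre; if M of them lie on the long leg, then M ≤ l and
-- M = 0 unless P ≥ 1, which gives P + L ≥ ⌊ (n + 1)/2 ⌋ − l + 1.  Equality holds for the
-- labelling giving the centre the label 1 and the vertices 1, …, ⌊ (n + 1)/2 ⌋ the even labels:
-- then P = 1, M = l, and exactly ⌊ (n + 1)/2 ⌋ vertices have parity opposite to the centre.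
module Submission where

open import Defs hiding (sym)
open import Data.Nat
  using (ℕ; zero; suc; _+_; _*_; _∸_; _≤_; _<_; z≤n; s≤s; z<s; s≤s⁻¹; s<s⁻¹; ⌊_/2⌋; ⌈_/2⌉;
         _%_; _≡ᵇ_; _<ᵇ_; _≤ᵇ_; _<?_)
open import Data.Nat.Properties
open import Data.Nat.DivMod using ([m+n]%n≡m%n)
open import Data.Nat.ListAction using (sum)
open import Data.Bool using (Bool; true; false; if_then_else_; _xor_; _∧_; _∨_)
open import Data.Bool.Properties using (∧-zeroʳ; ∧-identityʳ; ∨-identityʳ; xor-same)
open import Data.Fin using (Fin; toℕ; fromℕ<)
import Data.Fin as Fin
open import Data.Fin.Properties using (toℕ<n; toℕ-fromℕ<; toℕ-injective)
open import Data.List using (map; allFin; tabulate)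
open import Data.List.Properties using (map-tabulate)
open import Data.Product using (_,_)
open import Function using (_∘_; id)
open import Function.Bundles using (_⤖_; mk↔ₛ′)
open import Function.Properties.Bijection using (Bijection⇒Inverse)
open import Function.Properties.Inverse using (↔⇒⤖)
open import Relation.Nullary using (contradiction; yes; no)
open import Relation.Binary.PropositionalEquality
import Algebra.Properties.CommutativeMonoid.Sum +-0-commutativeMonoid as Σ

sumBelow : ℕ → (ℕ → ℕ) → ℕ
sumBelow p h = Σ.sum {p} (h ∘ toℕ)

sumBelow-cong : ∀ p {h h′ : ℕ → ℕ} → (∀ {j} → j < p → h j ≡ h′ j) →
                sumBelow p h ≡ sumBelow p h′
sumBelow-cong p eq = Σ.sum-cong-≗ (λ i → eq (toℕ<n i))

sumBelow-zero : ∀ p → sumBelow p (λ _ → 0) ≡ 0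
sumBelow-zero = Σ.sum-replicate-zero

sumBelow-ones : ∀ p → sumBelow p (λ _ → 1) ≡ p
sumBelow-ones zero    = refl
sumBelow-ones (suc p) = cong suc (sumBelow-ones p)

sumBelow-+ : ∀ m r (h : ℕ → ℕ) →
             sumBelow (m + r) h ≡ sumBelow m h + sumBelow r (λ k → h (m + k))
sumBelow-+ zero    r h = refl
sumBelow-+ (suc m) r h =
  trans (cong (h 0 +_) (sumBelow-+ m r (h ∘ suc))) (sym (+-assoc (h 0) _ _))

sumBelow-prefix : ∀ {m p} (h : ℕ → ℕ) → m ≤ p → sumBelow m h ≤ sumBelow p h
sumBelow-prefix {m} h m≤p with r , refl ← m≤n⇒∃[o]m+o≡n m≤p =
  subst (sumBelow m h ≤_) (sym (sumBelow-+ m r h)) (m≤m+n _ _)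

sumBelow-≤ : ∀ p {h : ℕ → ℕ} {c} → (∀ {j} → j < p → h j ≤ c) → sumBelow p h ≤ p * c
sumBelow-≤ zero    bound = z≤n
sumBelow-≤ (suc p) bound = +-mono-≤ (bound z<s) (sumBelow-≤ p (bound ∘ s≤s))

sumBelow-point : ∀ p {h : ℕ → ℕ} {a} → a < p → (∀ i → i ≢ a → h i ≡ 0) → sumBelow p h ≡ h a
sumBelow-point (suc p) {h} {zero} _ off =
  trans (cong (h 0 +_) (trans (sumBelow-cong p (λ {j} _ → off (suc j) λ ())) (sumBelow-zero p)))
        (+-identityʳ (h 0))
sumBelow-point (suc p) {h} {suc a} (s≤s a<p) off rewrite off 0 (λ ()) =
  sumBelow-point p a<p (λ i i≢a → off (suc i) (i≢a ∘ suc-injective))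

sum-allFin : ∀ {p} (h : Fin p → ℕ) → sum (map h (allFin p)) ≡ Σ.sum h
sum-allFin {p} h = trans (cong sum (map-tabulate id h)) (sum-tabulate h)
  where
  sum-tabulate : ∀ {q} (h : Fin q → ℕ) → sum (tabulate h) ≡ Σ.sum h
  sum-tabulate {zero}  h = refl
  sum-tabulate {suc q} h = cong (h Fin.zero +_) (sum-tabulate (h ∘ Fin.suc))

sum-label : ∀ {p} (f : Labelling p) (h : ℕ → ℕ) →
            Σ.sum (λ v → h (label f v)) ≡ sumBelow p (h ∘ suc)
sum-label f h = sym (Σ.sum-permute (h ∘ suc ∘ toℕ) (Bijection⇒Inverse f))

isOdd-+2 : ∀ m → isOdd (suc (suc m)) ≡ isOdd m
isOdd-+2 m = cong (_≡ᵇ 1) (trans (cong (_% 2) (+-comm 2 m)) ([m+n]%n≡m%n m 2))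

isOdd-double : ∀ k → isOdd (k + k) ≡ false
isOdd-double zero    = refl
isOdd-double (suc k) =
  trans (cong (isOdd ∘ suc) (+-suc k k)) (trans (isOdd-+2 (k + k)) (isOdd-double k))

oppParity≡xor : ∀ a b → oppParity a b ≡ isOdd a xor isOdd b
oppParity≡xor a b with isOdd a | isOdd b
... | true  | true  = refl
... | true  | false = refl
... | false | true  = refl
... | false | false = refl

-- Turns a predicate on vertices into one on ℕ; the value false beyond the last vertex is
-- never used.
extend : ∀ {p} → (Fin p → Bool) → ℕ → Bool
extend {zero}  q _       = false
extend {suc p} q zero    = q Fin.zero
extend {suc p} q (suc j) = extend (q ∘ Fin.suc) j

extend-toℕ : ∀ {p} (q : Fin p → Bool) v → extend q (toℕ v) ≡ q v
extend-toℕ {suc p} q Fin.zero    = refl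
extend-toℕ {suc p} q (Fin.suc v) = extend-toℕ (q ∘ Fin.suc) v

labelIsOdd : ∀ {p} → Labelling p → ℕ → Bool
labelIsOdd f = extend (λ v → isOdd (label f v))

disagree : (ℕ → Bool) → ℕ → ℕ → ℕ
disagree g i j = boolToℕ (g i xor g j)

xor-triangle : ∀ a b c → boolToℕ (a xor c) ≤ boolToℕ (a xor b) + boolToℕ (b xor c)
xor-triangle true  true  true  = z≤n
xor-triangle true  true  false = s≤s z≤n
xor-triangle true  false true  = z≤n
xor-triangle true  false false = s≤s z≤n
xor-triangle false true  true  = s≤s z≤n
xor-triangle false true  false = z≤n
xor-triangle false false true  = s≤s z≤n
xor-triangle false false false = z≤n

boolToℕ≤1 : ∀ b → boolToℕ b ≤ 1
boolToℕ≤1 true  = s≤s z≤n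
boolToℕ≤1 false = z≤n

labelsOfOtherParity : ∀ c p →
  sumBelow p (λ x → boolToℕ (c xor isOdd (suc x))) ≡ (if c then ⌊ p /2⌋ else ⌈ p /2⌉)
labelsOfOtherParity true  zero          = refl
labelsOfOtherParity false zero          = refl
labelsOfOtherParity true  (suc zero)    = refl
labelsOfOtherParity false (suc zero)    = refl
labelsOfOtherParity c     (suc (suc p)) =
  next-pair c (trans (sumBelow-cong p (λ {x} _ → cong (λ b → boolToℕ (c xor b)) (isOdd-+2 (suc x))))
                     (labelsOfOtherParity c p))
  where
  next-pair : ∀ c {s} → s ≡ (if c then ⌊ p /2⌋ else ⌈ p /2⌉) →
              boolToℕ (c xor true) + (boolToℕ (c xor false) + s) ≡
              (if c then suc ⌊ p /2⌋ else suc ⌈ p /2⌉)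
  next-pair true  = cong suc
  next-pair false = cong suc

disagreementsWithCentre : ∀ {p} (f : Labelling p) →
  sumBelow p (disagree (labelIsOdd f) 0) ≡ (if labelIsOdd f 0 then ⌊ p /2⌋ else ⌈ p /2⌉)
disagreementsWithCentre {p} f = begin
  sumBelow p (disagree (labelIsOdd f) 0)
    ≡⟨ Σ.sum-cong-≗ (λ v → cong (λ b → boolToℕ (c xor b)) (extend-toℕ oddLabel v)) ⟩
  Σ.sum (λ v → boolToℕ (c xor isOdd (label f v)))
    ≡⟨ sum-label f (λ m → boolToℕ (c xor isOdd m)) ⟩
  sumBelow p (λ x → boolToℕ (c xor isOdd (suc x)))
    ≡⟨ labelsOfOtherParity c p ⟩
  (if c then ⌊ p /2⌋ else ⌈ p /2⌉) ∎
  where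
  open ≡-Reasoning
  oddLabel : Fin p → Bool
  oddLabel w = isOdd (label f w)
  c : Bool
  c = labelIsOdd f 0

disagreementsWithCentre-≥ : ∀ {p} (f : Labelling p) →
                            ⌊ p /2⌋ ≤ sumBelow p (disagree (labelIsOdd f) 0)
disagreementsWithCentre-≥ {p} f with labelIsOdd f 0 | disagreementsWithCentre f
... | true  | eq = ≤-reflexive (sym eq)
... | false | eq = subst (⌊ p /2⌋ ≤_) (sym eq) (⌊n/2⌋≤⌈n/2⌉ p)

disagreementsWithOddCentre : ∀ {p} (f : Labelling p) → labelIsOdd f 0 ≡ true →
                             sumBelow p (disagree (labelIsOdd f) 0) ≡ ⌊ p /2⌋
disagreementsWithOddCentre f centreOdd with labelIsOdd f 0 | disagreementsWithCentre f
disagreementsWithOddCentre f refl | true | eq = eq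

<ᵇ-true : ∀ {m n} → m < n → (m <ᵇ n) ≡ true
<ᵇ-true {zero}  (s≤s _)   = refl
<ᵇ-true {suc m} (s≤s m<n) = <ᵇ-true m<n

<ᵇ-false : ∀ {m n} → n ≤ m → (m <ᵇ n) ≡ false
<ᵇ-false z≤n       = refl
<ᵇ-false (s≤s n≤m) = <ᵇ-false n≤m

≡ᵇ-false : ∀ {m n} → m ≢ n → (m ≡ᵇ n) ≡ false
≡ᵇ-false {zero}  {zero}  m≢n = contradiction refl m≢n
≡ᵇ-false {zero}  {suc n} _   = refl
≡ᵇ-false {suc m} {zero}  _   = refl
≡ᵇ-false {suc m} {suc n} m≢n = ≡ᵇ-false (m≢n ∘ cong suc)

≡ᵇ-refl : ∀ m → (m ≡ᵇ m) ≡ true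
≡ᵇ-refl zero    = refl
≡ᵇ-refl (suc m) = ≡ᵇ-refl m

spiderEdge-descending : ∀ l {i j} → j ≤ i → spiderEdge l i j ≡ false
spiderEdge-descending l {zero}      z≤n = refl
spiderEdge-descending l {suc i} {j} j≤i
  rewrite ≡ᵇ-false {j} {suc (suc i)} (λ { refl → 1+n≰n j≤i }) | ∧-zeroʳ (j ≤ᵇ l) = refl

spiderEdge-path : ∀ {l k} → k < l → ∀ i → spiderEdge l i (suc k) ≡ (k ≡ᵇ i)
spiderEdge-path {l} {k} k<l i
  rewrite <ᵇ-true k<l | <ᵇ-false {l} {suc k} k<l | ∧-zeroʳ (i ≡ᵇ 0) = ∨-identityʳ (k ≡ᵇ i)

spiderEdge-leaf : ∀ {l k} → l ≤ k → ∀ i → spiderEdge l i (suc k) ≡ (0 ≡ᵇ i)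
spiderEdge-leaf {l} {k} l≤k zero
  rewrite <ᵇ-false {k} {l} l≤k | <ᵇ-true {l} {suc k} (s≤s l≤k) = refl
spiderEdge-leaf {l} {k} l≤k (suc i)
  rewrite <ᵇ-false {k} {l} l≤k = refl

-- The summand of negEdges for the vertices numbered i and j.
negativeEdge : ℕ → (ℕ → Bool) → ℕ → ℕ → ℕ
negativeEdge l g i j = boolToℕ ((i <ᵇ j) ∧ (spiderEdge l i j ∨ spiderEdge l j i) ∧ (g i xor g j))

negativeEdges-into : ∀ l g {a k} p → a ≤ k → k < p → (∀ i → spiderEdge l i (suc k) ≡ (a ≡ᵇ i)) →
                     sumBelow p (λ i → negativeEdge l g i (suc k)) ≡ disagree g a (suc k)
negativeEdges-into l g {a} {k} p a≤k k<p edge =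
  trans (sumBelow-point p (≤-<-trans a≤k k<p) off) at-a
  where
  at-a : negativeEdge l g a (suc k) ≡ disagree g a (suc k)
  at-a rewrite <ᵇ-true (s≤s a≤k) | edge a | ≡ᵇ-refl a = refl
  off : ∀ i → i ≢ a → negativeEdge l g i (suc k) ≡ 0
  off i i≢a with i ≤? k
  ... | yes i≤k rewrite <ᵇ-true (s≤s i≤k) | edge i | ≡ᵇ-false (i≢a ∘ sym)
                      | spiderEdge-descending l (m≤n⇒m≤1+n i≤k) = refl
  ... | no  i≰k rewrite <ᵇ-false (≰⇒> i≰k) = refl

pathDisagreements : (ℕ → Bool) → ℕ → ℕ
pathDisagreements g l = sumBelow l (λ k → disagree g k (suc k))

leafDisagreements : (ℕ → Bool) → ℕ → ℕ → ℕ
leafDisagreements g l r = sumBelow r (λ k → disagree g 0 (suc (l + k)))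

negEdges-spider-∑ : ∀ n l (f : Labelling (suc n)) →
  negEdges (spider n l) f ≡
  sumBelow (suc n) (λ i → sumBelow (suc n) (λ j → negativeEdge l (labelIsOdd f) i j))
negEdges-spider-∑ n l f = begin
  negEdges (spider n l) f
    ≡⟨ sum-allFin (λ u → sum (map (term u) (allFin (suc n)))) ⟩
  Σ.sum (λ u → sum (map (term u) (allFin (suc n))))
    ≡⟨ Σ.sum-cong-≗ (λ u → trans (sum-allFin (term u)) (Σ.sum-cong-≗ (term≡ u))) ⟩
  sumBelow (suc n) (λ i → sumBelow (suc n) (λ j → negativeEdge l (labelIsOdd f) i j)) ∎
  where
  open ≡-Reasoning
  oddLabel : Fin (suc n) → Bool
  oddLabel w = isOdd (label f w)
  term : Fin (suc n) → Fin (suc n) → ℕ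
  term u v = boolToℕ ((toℕ u <ᵇ toℕ v) ∧ adj (spider n l) u v ∧ oppParity (label f u) (label f v))
  term≡ : ∀ u v → term u v ≡ negativeEdge l (labelIsOdd f) (toℕ u) (toℕ v)
  term≡ u v rewrite oppParity≡xor (label f u) (label f v)
                  | extend-toℕ oddLabel u | extend-toℕ oddLabel v = refl

negEdges-spider : ∀ l r (f : Labelling (suc (l + r))) →
  negEdges (spider (l + r) l) f ≡
  pathDisagreements (labelIsOdd f) l + leafDisagreements (labelIsOdd f) l r
negEdges-spider l r f = begin
  negEdges (spider n l) f
    ≡⟨ negEdges-spider-∑ n l f ⟩
  sumBelow p (λ i → sumBelow p (λ j → negativeEdge l g i j))
    ≡⟨ Σ.∑-comm {p} {p} (λ u v → negativeEdge l g (toℕ u) (toℕ v)) ⟩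
  sumBelow p (λ j → sumBelow p (λ i → negativeEdge l g i j))
    ≡⟨ cong (_+ sumBelow n into) (sumBelow-zero p) ⟩
  sumBelow n into
    ≡⟨ sumBelow-+ l r into ⟩
  sumBelow l into + sumBelow r (λ k → into (l + k))
    ≡⟨ cong₂ _+_ (sumBelow-cong l path) (sumBelow-cong r leaf) ⟩
  pathDisagreements g l + leafDisagreements g l r ∎
  where
  open ≡-Reasoning
  n p : ℕ
  n = l + r
  p = suc n
  g : ℕ → Bool
  g = labelIsOdd f
  into : ℕ → ℕ
  into k = sumBelow p (λ i → negativeEdge l g i (suc k))
  path : ∀ {k} → k < l → into k ≡ disagree g k (suc k)
  path k<l = negativeEdges-into l g p ≤-refl (s≤s (≤-trans (<⇒≤ k<l) (m≤m+n l r)))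
                                (spiderEdge-path k<l)
  leaf : ∀ {k} → k < r → into (l + k) ≡ disagree g 0 (suc (l + k))
  leaf {k} k<r = negativeEdges-into l g p z≤n (s≤s (+-monoʳ-≤ l (<⇒≤ k<r)))
                                    (spiderEdge-leaf (m≤m+n l k))

disagreementsWithCentre-split : ∀ g l r →
  sumBelow (suc (l + r)) (disagree g 0) ≡
  sumBelow l (λ k → disagree g 0 (suc k)) + leafDisagreements g l r
disagreementsWithCentre-split g l r =
  trans (cong (_+ sumBelow (l + r) (λ k → disagree g 0 (suc k))) (cong boolToℕ (xor-same (g 0))))
        (sumBelow-+ l r (λ k → disagree g 0 (suc k)))

-- The lower bound

disagree-≤-path : ∀ g j → disagree g 0 j ≤ pathDisagreements g j
disagree-≤-path g zero    rewrite xor-same (g 0) = z≤n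
disagree-≤-path g (suc j) = ≤-trans (xor-triangle (g 0) (g 1) (g (suc j)))
                                    (+-monoʳ-≤ (disagree g 0 1) (disagree-≤-path (g ∘ suc) j))

lowerBound-arithmetic : ∀ {e l P M L} → 1 ≤ l → l ≤ e → M ≤ l → M ≤ l * P → e ≤ M + L →
                        e ∸ l + 1 ≤ P + L
lowerBound-arithmetic {e} {l} {zero} 1≤l l≤e _ M≤0 e≤M+L rewrite *-zeroʳ l | n≤0⇒n≡0 M≤0 =
  ≤-trans (subst (e ∸ l + 1 ≤_) (m∸n+n≡m l≤e) (+-monoʳ-≤ (e ∸ l) 1≤l)) e≤M+L
lowerBound-arithmetic {e} {l} {suc P} {L = L} _ _ M≤l _ e≤M+L =
  subst (_≤ suc P + L) (+-comm 1 (e ∸ l)) (s≤s (≤-trans e∸l≤L (m≤n+m L P)))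
  where
  e∸l≤L : e ∸ l ≤ L
  e∸l≤L = m≤n+o⇒m∸n≤o e l (≤-trans e≤M+L (+-monoˡ-≤ L M≤l))

negEdges-spider-≥ : ∀ l r → 1 ≤ l → l ≤ ⌊ suc (l + r) /2⌋ → (f : Labelling (suc (l + r))) →
                    ⌊ suc (l + r) /2⌋ ∸ l + 1 ≤ negEdges (spider (l + r) l) f
negEdges-spider-≥ l r 1≤l l≤e f rewrite negEdges-spider l r f =
  lowerBound-arithmetic 1≤l l≤e
    (subst (M ≤_) (*-identityʳ l) (sumBelow-≤ l (λ {k} _ → boolToℕ≤1 (g 0 xor g (suc k)))))
    (sumBelow-≤ l (λ {k} k<l → ≤-trans (disagree-≤-path g (suc k)) (sumBelow-prefix pathTerm k<l)))
    (subst (⌊ suc (l + r) /2⌋ ≤_) (disagreementsWithCentre-split g l r)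
           (disagreementsWithCentre-≥ f))
  where
  g : ℕ → Bool
  g = labelIsOdd f
  M : ℕ
  M = sumBelow l (λ k → disagree g 0 (suc k))
  pathTerm : ℕ → ℕ
  pathTerm i = disagree g i (suc i)

-- The upper bound

negEdges-spider-≡ : ∀ l r → 1 ≤ l → (f : Labelling (suc (l + r))) → labelIsOdd f 0 ≡ true →
                    (∀ {k} → k < l → labelIsOdd f (suc k) ≡ false) →
                    negEdges (spider (l + r) l) f ≡ ⌊ suc (l + r) /2⌋ ∸ l + 1
negEdges-spider-≡ l@(suc l′) r (s≤s z≤n) f centreOdd pathEven = begin
  negEdges (spider (l + r) l) f  ≡⟨ negEdges-spider l r f ⟩
  pathDisagreements g l + L      ≡⟨ cong (_+ L) path≡1 ⟩
  1 + L                          ≡⟨ +-comm 1 L ⟩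
  L + 1                          ≡⟨ cong (_+ 1) (sym (trans (cong (_∸ l) e≡l+L) (m+n∸m≡n l L))) ⟩
  ⌊ suc (l + r) /2⌋ ∸ l + 1      ∎
  where
  open ≡-Reasoning
  g : ℕ → Bool
  g = labelIsOdd f
  L : ℕ
  L = leafDisagreements g l r
  path≡1 : pathDisagreements g l ≡ 1
  path≡1 rewrite centreOdd | pathEven {0} z<s =
    cong suc (trans (sumBelow-cong l′ (λ k<l′ → cong₂ (λ a b → boolToℕ (a xor b))
                                                      (pathEven (s≤s (<⇒≤ k<l′)))
                                                      (pathEven (s≤s k<l′))))
                    (sumBelow-zero l′))
  centre≢path : ∀ {k} → k < l → disagree g 0 (suc k) ≡ 1
  centre≢path k<l rewrite centreOdd | pathEven k<l = refl
  e≡l+L : ⌊ suc (l + r) /2⌋ ≡ l + L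
  e≡l+L = begin
    ⌊ suc (l + r) /2⌋                            ≡⟨ sym (disagreementsWithOddCentre f centreOdd) ⟩
    sumBelow (suc (l + r)) (disagree g 0)        ≡⟨ disagreementsWithCentre-split g l r ⟩
    sumBelow l (λ k → disagree g 0 (suc k)) + L  ≡⟨ cong (_+ L) (sumBelow-cong l centre≢path) ⟩
    sumBelow l (λ _ → 1) + L                     ≡⟨ cong (_+ L) (sumBelow-ones l) ⟩
    l + L                                        ∎

k<⌊n/2⌋⇒1+k+k<n : ∀ {k n} → k < ⌊ n /2⌋ → suc (k + k) < n
k<⌊n/2⌋⇒1+k+k<n {k} {n} k<e =
  subst (_≤ n) (cong suc (+-suc k k)) (≤-trans (+-mono-≤ k<e k<e) e+e≤n)
  where
  e+e≤n : ⌊ n /2⌋ + ⌊ n /2⌋ ≤ n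
  e+e≤n = subst (⌊ n /2⌋ + ⌊ n /2⌋ ≤_) (⌊n/2⌋+⌈n/2⌉≡n n) (+-monoʳ-≤ ⌊ n /2⌋ (⌊n/2⌋≤⌈n/2⌉ n))

1+k+k<n⇒k<⌊n/2⌋ : ∀ {k n} → suc (k + k) < n → k < ⌊ n /2⌋
1+k+k<n⇒k<⌊n/2⌋ {k} {n} lt = subst (_≤ ⌊ n /2⌋) (sym (n≡⌊n+n/2⌋ (suc k)))
                                   (⌊n/2⌋-mono (subst (_≤ n) (cong suc (sym (+-suc k k))) lt))

k<⌈n/2⌉⇒k+k<n : ∀ {k n} → k < ⌈ n /2⌉ → k + k < n
k<⌈n/2⌉⇒k+k<n k<c = s<s⁻¹ (k<⌊n/2⌋⇒1+k+k<n k<c)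

k+k<n⇒k<⌈n/2⌉ : ∀ {k n} → k + k < n → k < ⌈ n /2⌉
k+k<n⇒k<⌈n/2⌉ lt = 1+k+k<n⇒k<⌊n/2⌋ (s≤s lt)

interleave : ℕ → ℕ → ℕ
interleave e zero    = zero
interleave e (suc k) with k <? e
... | yes _ = suc (k + k)
... | no  _ = suc (k ∸ e) + suc (k ∸ e)

deinterleave : ℕ → ℕ → ℕ
deinterleave e 0                   = 0
deinterleave e 1                   = 1
deinterleave e 2                   = suc e
deinterleave e (suc (suc (suc x))) = suc (deinterleave e (suc x))

deinterleave-odd : ∀ e k → deinterleave e (suc (k + k)) ≡ suc k
deinterleave-odd e zero    = refl
deinterleave-odd e (suc k) rewrite +-suc k k = cong suc (deinterleave-odd e k)

deinterleave-even : ∀ e d → deinterleave e (suc d + suc d) ≡ suc (e + d)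
deinterleave-even e zero    = cong suc (sym (+-identityʳ e))
deinterleave-even e (suc d) rewrite +-suc d (suc d) | +-suc e d = cong suc (deinterleave-even e d)

deinterleave∘interleave : ∀ e v → deinterleave e (interleave e v) ≡ v
deinterleave∘interleave e zero = refl
deinterleave∘interleave e (suc k) with k <? e
... | yes _   = deinterleave-odd e k
... | no  k≮e = trans (deinterleave-even e (k ∸ e)) (cong suc (m+[n∸m]≡n (≮⇒≥ k≮e)))

data PositionParity : ℕ → Set where
  origin : PositionParity 0
  odd    : ∀ k → PositionParity (suc (k + k))
  even   : ∀ d → PositionParity (suc d + suc d)

positionParity : ∀ x → PositionParity x
positionParity 0 = origin
positionParity 1 = odd 0
positionParity 2 = even 0
positionParity (suc (suc (suc x))) with positionParity (suc x)
... | odd k  = subst (PositionParity ∘ suc ∘ suc) (+-suc k k) (odd (suc k))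
... | even d = subst (PositionParity ∘ suc ∘ suc) (+-suc d (suc d)) (even (suc d))

interleave∘deinterleave : ∀ {p x} → x < p → interleave ⌊ p /2⌋ (deinterleave ⌊ p /2⌋ x) ≡ x
interleave∘deinterleave {p} {x} x<p with positionParity x
... | origin = refl
... | odd k rewrite deinterleave-odd ⌊ p /2⌋ k with k <? ⌊ p /2⌋
...   | yes _   = refl
...   | no  k≮e = contradiction (1+k+k<n⇒k<⌊n/2⌋ x<p) k≮e
interleave∘deinterleave {p} {x} x<p | even d
  rewrite deinterleave-even ⌊ p /2⌋ d with ⌊ p /2⌋ + d <? ⌊ p /2⌋
...   | yes e+d<e = contradiction e+d<e (m+n≮m _ d)
...   | no  _     rewrite m+n∸m≡n ⌊ p /2⌋ d = refl

interleave-< : ∀ {p v} → v < p → interleave ⌊ p /2⌋ v < p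
interleave-< {p} {zero}  0<p = 0<p
interleave-< {p} {suc k} v<p with k <? ⌊ p /2⌋
... | yes k<e = k<⌊n/2⌋⇒1+k+k<n k<e
... | no  k≮e =
  k<⌈n/2⌉⇒k+k<n (+-cancelˡ-< ⌊ p /2⌋ _ _ (subst₂ _<_ v≡e+1+d (sym (⌊n/2⌋+⌈n/2⌉≡n p)) v<p))
  where
  v≡e+1+d : suc k ≡ ⌊ p /2⌋ + suc (k ∸ ⌊ p /2⌋)
  v≡e+1+d = sym (trans (+-suc ⌊ p /2⌋ _) (cong suc (m+[n∸m]≡n (≮⇒≥ k≮e))))

deinterleave-< : ∀ {p x} → x < p → deinterleave ⌊ p /2⌋ x < p
deinterleave-< {p} {x} x<p with positionParity x
... | origin = x<p
... | odd k  rewrite deinterleave-odd ⌊ p /2⌋ k = ≤-<-trans (s≤s (m≤m+n k k)) x<p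
... | even d rewrite deinterleave-even ⌊ p /2⌋ d =
  subst₂ _<_ (+-suc ⌊ p /2⌋ d) (⌊n/2⌋+⌈n/2⌉≡n p) (+-monoʳ-< ⌊ p /2⌋ (k+k<n⇒k<⌈n/2⌉ x<p))

finBijection : ∀ {p} (φ ψ : ℕ → ℕ) (φ< : ∀ {x} → x < p → φ x < p) (ψ< : ∀ {x} → x < p → ψ x < p) →
               (∀ {x} → x < p → ψ (φ x) ≡ x) → (∀ {x} → x < p → φ (ψ x) ≡ x) → Fin p ⤖ Fin p
finBijection {p} φ ψ φ< ψ< ψφ φψ =
  ↔⇒⤖ (mk↔ₛ′ (restrict φ φ<) (restrict ψ ψ<) (inverse φ ψ φ< ψ< φψ) (inverse ψ φ ψ< φ< ψφ))
  where
  restrict : (χ : ℕ → ℕ) → (∀ {x} → x < p → χ x < p) → Fin p → Fin p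
  restrict χ χ< v = fromℕ< (χ< (toℕ<n v))
  inverse : ∀ χ ω (χ< : ∀ {x} → x < p → χ x < p) (ω< : ∀ {x} → x < p → ω x < p) →
            (∀ {x} → x < p → χ (ω x) ≡ x) → ∀ v → restrict χ χ< (restrict ω ω< v) ≡ v
  inverse χ ω χ< ω< χω v = toℕ-injective (begin
    toℕ (fromℕ< _)      ≡⟨ toℕ-fromℕ< _ ⟩
    χ (toℕ (fromℕ< _))  ≡⟨ cong χ (toℕ-fromℕ< _) ⟩
    χ (ω (toℕ v))       ≡⟨ χω (toℕ<n v) ⟩
    toℕ v               ∎)
    where open ≡-Reasoning

interleaving : ∀ p → Labelling p
interleaving p = finBijection (interleave ⌊ p /2⌋) (deinterleave ⌊ p /2⌋) interleave-< deinterleave-<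
                              (λ {v} _ → deinterleave∘interleave ⌊ p /2⌋ v) interleave∘deinterleave

labelIsOdd-interleaving : ∀ {p j} → j < p →
                          labelIsOdd (interleaving p) j ≡ isOdd (suc (interleave ⌊ p /2⌋ j))
labelIsOdd-interleaving {p} {j} j<p = begin
  extend oddLabel j
    ≡⟨ cong (extend oddLabel) (sym (toℕ-fromℕ< j<p)) ⟩
  extend oddLabel (toℕ v)
    ≡⟨ extend-toℕ oddLabel v ⟩
  isOdd (suc (toℕ (fromℕ< (interleave-< (toℕ<n v)))))
    ≡⟨ cong (isOdd ∘ suc) (toℕ-fromℕ< (interleave-< {p} (toℕ<n v))) ⟩
  isOdd (suc (interleave ⌊ p /2⌋ (toℕ v)))
    ≡⟨ cong (isOdd ∘ suc ∘ interleave ⌊ p /2⌋) (toℕ-fromℕ< j<p) ⟩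
  isOdd (suc (interleave ⌊ p /2⌋ j)) ∎
  where
  open ≡-Reasoning
  oddLabel : Fin p → Bool
  oddLabel w = isOdd (label (interleaving p) w)
  v : Fin p
  v = fromℕ< j<p

interleaving-centre : ∀ n → labelIsOdd (interleaving (suc n)) 0 ≡ true
interleaving-centre n = labelIsOdd-interleaving {suc n} z<s

interleaving-path : ∀ {p k} → k < ⌊ p /2⌋ → labelIsOdd (interleaving p) (suc k) ≡ false
interleaving-path {p} {k} k<e =
  trans (labelIsOdd-interleaving (≤-<-trans (s≤s (m≤m+n k k)) (k<⌊n/2⌋⇒1+k+k<n k<e)))
        odd-position
  where
  odd-position : isOdd (suc (interleave ⌊ p /2⌋ (suc k))) ≡ false
  odd-position with k <? ⌊ p /2⌋
  ... | yes _   = trans (isOdd-+2 (k + k)) (isOdd-double k)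
  ... | no  k≮e = contradiction k<e k≮e

spiderRnaNumber : ∀ l r → 1 ≤ l → l ≤ ⌊ suc (l + r) /2⌋ →
                  IsRnaNumber (spider (l + r) l) (⌊ suc (l + r) /2⌋ ∸ l + 1)
spiderRnaNumber l r 1≤l l≤e =
  (interleaving p , negEdges-spider-≡ l r 1≤l (interleaving p) (interleaving-centre (l + r))
                                      (λ k<l → interleaving-path (<-≤-trans k<l l≤e))) ,
  negEdges-spider-≥ l r 1≤l l≤e
  where
  p : ℕ
  p = suc (l + r)

mainTheorem8 : ∀ (n l : ℕ) → 1 ≤ n → 1 ≤ l → l ≤ ⌊ n + 1 /2⌋ →
    IsRnaNumber (spider n l) (⌊ n + 1 /2⌋ ∸ l + 1)
mainTheorem8 n l _ 1≤l l≤e rewrite +-comm n 1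
  with r , refl ← m≤n⇒∃[o]m+o≡n (≤-trans l≤e (s≤s⁻¹ (⌊n/2⌋<n n))) =
  spiderRnaNumber l r 1≤l l≤e
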